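{- Let $a,b,c$ be odd integers and let $\mathcal{L}$ be the equation $ax+by+cz=0$. If $R(\mathcal{L},\mathbb{Z}/3\mathbb{Z})$ exists, then $\mathcal{L}$ admits no EGZ-generalization, i.e. $R(\mathcal{L},2)\neq R(\mathcal{L},\mathbb{Z}/3\mathbb{Z})$.
   Context: $[1,n]=\{1,\dots,n\}$. For an equation $\mathcal{L}$ in three variables and a coloring $\chi:[1,n]\to\{0,\dots,r-1\}$, a solution $(x_1,x_2,x_3)\in[1,n]^3$ is monochromatic if all $\chi(x_i)$ are equal, and zero-sum (for $r=3$) if $\chi(x_1)+\chi(x_2)+\chi(x_3)\equiv0\pmod 3$. $R(\mathcal{L},2)$ is the least $N$ (if it exists) such that for all $n\ge N$ every $2$-coloring of $[1,n]$ has a monochromatic solution of $\mathcal{L}$; $R(\mathcal{L},\mathbb{Z}/3\mathbb{Z})$ is the least $N$ (if it exists) such that for all $n\ge N$ every map $[1,n]\to\{0,1,2\}$ has a zero-sum solution of $\mathcal{L}$. $\mathcal{L}$ admits an EGZ-generalization if $R(\mathcal{L},2)=R(\mathcal{L},\mathbb{Z}/3\mathbb{Z})$. -}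

module Defs where

open import Data.Nat as ℕ using (ℕ; _≤_; _%_; _+_)
open import Data.Integer as ℤ using (ℤ; +_; 0ℤ)
open import Data.Integer.Divisibility as ℤD using ()
open import Data.Fin using (Fin; toℕ)
open import Data.Product using (Σ; _×_; ∃-syntax)
open import Relation.Binary.PropositionalEquality using (_≡_)
open import Relation.Nullary using (¬_)

Odd : ℤ → Set
Odd a = ¬ (+ 2 ℤD.∣ a)

InRange : ℕ → ℕ → Set
InRange n x = 1 ≤ x × x ≤ n

IsSolution : ℤ → ℤ → ℤ → ℕ → ℕ → ℕ → ℕ → Set
IsSolution a b c n x y z =
  InRange n x × InRange n y × InRange n z ×
  (a ℤ.* + x ℤ.+ b ℤ.* + y ℤ.+ c ℤ.* + z ≡ 0ℤ)

-- every 2-coloring of [1,n] has a monochromatic solution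
-- (colorings given as maps ℕ → Fin 2; only values on [1,n] matter)
MonoProp : ℤ → ℤ → ℤ → ℕ → Set
MonoProp a b c n = (χ : ℕ → Fin 2) →
  ∃[ x ] ∃[ y ] ∃[ z ] (IsSolution a b c n x y z × χ x ≡ χ y × χ y ≡ χ z)

ZeroSumProp : ℤ → ℤ → ℤ → ℕ → Set
ZeroSumProp a b c n = (χ : ℕ → Fin 3) →
  ∃[ x ] ∃[ y ] ∃[ z ] (IsSolution a b c n x y z ×
    ((toℕ (χ x) + toℕ (χ y) + toℕ (χ z)) % 3 ≡ 0))

Eventually : (ℕ → Set) → ℕ → Set
Eventually P N = ∀ n → N ≤ n → P n

IsLeast : (ℕ → Set) → ℕ → Set
IsLeast Q N = Q N × (∀ M → Q M → N ≤ M)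

IsR2 : ℤ → ℤ → ℤ → ℕ → Set
IsR2 a b c N = IsLeast (Eventually (MonoProp a b c)) N

IsRZ3 : ℤ → ℤ → ℤ → ℕ → Set
IsRZ3 a b c N = IsLeast (Eventually (ZeroSumProp a b c)) N

module Submission where

-- Since a, b, c are odd, every solution has x + y + z even. Lift a 2-colouring χ of [1,m]
-- to a 3-colouring of [1,2m] by giving odd numbers colour 2 and 2q colour χ q. A zero-sum
-- solution cannot have two odd entries (2 + 2 + {0,1} is not divisible by 3), so all entries
-- are even, their colours in {0,1} sum to 0 mod 3 and are therefore equal, and halving gives
-- a monochromatic solution in [1,m]. Hence R(L,2) ≤ R(L,Z/3Z) - 1; the cases R(L,Z/3Z) ≤ 1
-- are impossible because (1,1,1) has odd coordinate sum.

open import Defs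
open import Data.Nat using (ℕ)
open import Data.Integer using (ℤ)
open import Relation.Nullary using (¬_)
open import Data.Nat as ℕ using (zero; suc; z≤n; s≤s; _%_; _/_; NonZero)
open import Data.Nat.Properties using (n≮n; ≤-refl; ≤-trans; m≤m*n; *-cancelʳ-≤)
open import Data.Nat.DivMod using (_mod_; _divMod_; DivMod)
open import Data.Nat.Divisibility as ℕD using (n∣m*n; ∣m+n∣m⇒∣n; n∣m⇒m%n≡0)
open import Data.Integer as ℤ using (+_; 0ℤ; -_; ∣_∣)
open import Data.Integer.Properties using (abs-*; pos-+; pos-*; +-identityˡ; *-cancelʳ-≡)
open import Data.Integer.DivMod using (a≡a%n+[a/n]*n; n%d<d)
open import Data.Integer.Divisibility using (divides)
import Data.Integer.Tactic.RingSolver as ℤ-Solver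
import Data.Nat.Tactic.RingSolver as ℕ-Solver
open import Data.Fin using (Fin; toℕ; zero; suc)
open import Data.Product using (∃-syntax; _×_; _,_)
open import Function using (case_of_)
open import Relation.Binary.PropositionalEquality

IsSolution-resp : ∀ {a b c n x y z x′ y′ z′} → x ≡ x′ → y ≡ y′ → z ≡ z′ →
  IsSolution a b c n x y z → IsSolution a b c n x′ y′ z′
IsSolution-resp refl refl refl sol = sol

InRange-cancelʳ : ∀ k .{{_ : NonZero k}} {n x} → InRange (n ℕ.* k) (x ℕ.* k) → InRange n x
InRange-cancelʳ k {x = zero} (() , _)
InRange-cancelʳ k {n} {x = suc x} (_ , x*k≤n*k) = s≤s z≤n , *-cancelʳ-≤ (suc x) n k x*k≤n*k

IsSolution-cancelʳ : ∀ k .{{_ : NonZero k}} {a b c n x y z} →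
  IsSolution a b c (n ℕ.* k) (x ℕ.* k) (y ℕ.* k) (z ℕ.* k) → IsSolution a b c n x y z
IsSolution-cancelʳ k {a} {b} {c} {x = x} {y} {z} (x∈ , y∈ , z∈ , eq) =
  InRange-cancelʳ k x∈ , InRange-cancelʳ k y∈ , InRange-cancelʳ k z∈ ,
  *-cancelʳ-≡ _ 0ℤ (+ k) (begin
    (a ℤ.* + x ℤ.+ b ℤ.* + y ℤ.+ c ℤ.* + z) ℤ.* + k
      ≡⟨ linear-form-* a b c (+ x) (+ y) (+ z) (+ k) ⟩
    a ℤ.* (+ x ℤ.* + k) ℤ.+ b ℤ.* (+ y ℤ.* + k) ℤ.+ c ℤ.* (+ z ℤ.* + k)
      ≡⟨ sym (cong₂ ℤ._+_ (cong₂ ℤ._+_ (cong (a ℤ.*_) (pos-* x k)) (cong (b ℤ.*_) (pos-* y k)))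
                          (cong (c ℤ.*_) (pos-* z k))) ⟩
    a ℤ.* + (x ℕ.* k) ℤ.+ b ℤ.* + (y ℕ.* k) ℤ.+ c ℤ.* + (z ℕ.* k)
      ≡⟨ eq ⟩
    0ℤ ∎)
  where
  open ≡-Reasoning
  linear-form-* : ∀ a b c X Y Z K → (a ℤ.* X ℤ.+ b ℤ.* Y ℤ.+ c ℤ.* Z) ℤ.* K
    ≡ a ℤ.* (X ℤ.* K) ℤ.+ b ℤ.* (Y ℤ.* K) ℤ.+ c ℤ.* (Z ℤ.* K)
  linear-form-* = ℤ-Solver.solve-∀

InRange-1 : ∀ {x} → InRange 1 x → x ≡ 1
InRange-1 (s≤s z≤n , s≤s z≤n) = refl

Odd⇒1+k*2 : ∀ a → Odd a → ∃[ k ] a ≡ + 1 ℤ.+ k ℤ.* + 2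
Odd⇒1+k*2 a odd with a ℤ.% + 2 | a≡a%n+[a/n]*n a (+ 2) | n%d<d a (+ 2)
... | 0 | a≡[a/2]*2 | _ = case odd (divides ∣ a ℤ./ + 2 ∣ (begin
      ∣ a ∣                      ≡⟨ cong ∣_∣ (trans a≡[a/2]*2 (+-identityˡ (a ℤ./ + 2 ℤ.* + 2))) ⟩
      ∣ a ℤ./ + 2 ℤ.* + 2 ∣      ≡⟨ abs-* (a ℤ./ + 2) (+ 2) ⟩
      ∣ a ℤ./ + 2 ∣ ℕ.* 2        ∎)) of λ ()
  where open ≡-Reasoning
... | 1 | a≡1+[a/2]*2 | _ = a ℤ./ + 2 , a≡1+[a/2]*2
... | suc (suc _) | _ | s≤s (s≤s ())

solution-sum-even : ∀ a b c {x y z} → Odd a → Odd b → Odd c →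
  a ℤ.* + x ℤ.+ b ℤ.* + y ℤ.+ c ℤ.* + z ≡ 0ℤ → 2 ℕD.∣ x ℕ.+ y ℕ.+ z
solution-sum-even a b c {x} {y} {z} odd-a odd-b odd-c eq
  with Odd⇒1+k*2 a odd-a | Odd⇒1+k*2 b odd-b | Odd⇒1+k*2 c odd-c
... | ka , refl | kb , refl | kc , refl = subst (2 ℕD.∣_) ∣sum∣≡ (n∣m*n ∣ - K ∣)
  where
  K = ka ℤ.* + x ℤ.+ kb ℤ.* + y ℤ.+ kc ℤ.* + z
  open ≡-Reasoning
  -- (1 + 2k) X ≡ X modulo 2, with the multiple of 2 added on the left to avoid subtraction
  odd-linear-form : ∀ ka kb kc X Y Z →
    (+ 1 ℤ.+ ka ℤ.* + 2) ℤ.* X ℤ.+ (+ 1 ℤ.+ kb ℤ.* + 2) ℤ.* Y ℤ.+ (+ 1 ℤ.+ kc ℤ.* + 2) ℤ.* Z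
      ℤ.+ (- (ka ℤ.* X ℤ.+ kb ℤ.* Y ℤ.+ kc ℤ.* Z)) ℤ.* + 2 ≡ X ℤ.+ Y ℤ.+ Z
  odd-linear-form = ℤ-Solver.solve-∀
  ∣sum∣≡ : ∣ - K ∣ ℕ.* 2 ≡ x ℕ.+ y ℕ.+ z
  ∣sum∣≡ = trans (sym (abs-* (- K) (+ 2))) (cong ∣_∣ (begin
    - K ℤ.* + 2                                ≡⟨ sym (+-identityˡ _) ⟩
    0ℤ ℤ.+ - K ℤ.* + 2                         ≡⟨ cong (ℤ._+ - K ℤ.* + 2) (sym eq) ⟩
    _                                          ≡⟨ odd-linear-form ka kb kc (+ x) (+ y) (+ z) ⟩
    + x ℤ.+ + y ℤ.+ + z                        ≡⟨ sym (trans (pos-+ (x ℕ.+ y) z) (cong (ℤ._+ + z) (pos-+ x y))) ⟩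
    + (x ℕ.+ y ℕ.+ z)                          ∎))

liftColour : Fin 2 → Fin 2 → Fin 3
liftColour zero zero = zero
liftColour zero (suc zero) = suc zero
liftColour (suc zero) _ = suc (suc zero)

lift : (ℕ → Fin 2) → ℕ → Fin 3
lift χ x = liftColour (x mod 2) (χ (x / 2))

binary-zeroSum⇒constant : ∀ f g h →
  (toℕ (liftColour zero f) ℕ.+ toℕ (liftColour zero g) ℕ.+ toℕ (liftColour zero h)) % 3 ≡ 0 →
  f ≡ g × g ≡ h
binary-zeroSum⇒constant zero       zero       zero       _  = refl , refl
binary-zeroSum⇒constant zero       zero       (suc zero) ()
binary-zeroSum⇒constant zero       (suc zero) zero       ()
binary-zeroSum⇒constant zero       (suc zero) (suc zero) ()
binary-zeroSum⇒constant (suc zero) zero       zero       ()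
binary-zeroSum⇒constant (suc zero) zero       (suc zero) ()
binary-zeroSum⇒constant (suc zero) (suc zero) zero       ()
binary-zeroSum⇒constant (suc zero) (suc zero) (suc zero) _  = refl , refl

liftColour-zeroSum : ∀ p q r f g h → (toℕ p ℕ.+ toℕ q ℕ.+ toℕ r) % 2 ≡ 0 →
  (toℕ (liftColour p f) ℕ.+ toℕ (liftColour q g) ℕ.+ toℕ (liftColour r h)) % 3 ≡ 0 →
  p ≡ zero × q ≡ zero × r ≡ zero × f ≡ g × g ≡ h
liftColour-zeroSum zero       zero       zero       f g h _ zs = refl , refl , refl , binary-zeroSum⇒constant f g h zs
liftColour-zeroSum zero       zero       (suc zero) _ _ _ () _
liftColour-zeroSum zero       (suc zero) zero       _ _ _ () _
liftColour-zeroSum (suc zero) zero       zero       _ _ _ () _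
liftColour-zeroSum (suc zero) (suc zero) (suc zero) _ _ _ () _
liftColour-zeroSum zero       (suc zero) (suc zero) zero       _ _ _ ()
liftColour-zeroSum zero       (suc zero) (suc zero) (suc zero) _ _ _ ()
liftColour-zeroSum (suc zero) zero       (suc zero) _ zero       _ _ ()
liftColour-zeroSum (suc zero) zero       (suc zero) _ (suc zero) _ _ ()
liftColour-zeroSum (suc zero) (suc zero) zero       _ _ zero       _ ()
liftColour-zeroSum (suc zero) (suc zero) zero       _ _ (suc zero) _ ()

residues-sum-even : ∀ x y z → 2 ℕD.∣ x ℕ.+ y ℕ.+ z →
  (toℕ (x mod 2) ℕ.+ toℕ (y mod 2) ℕ.+ toℕ (z mod 2)) % 2 ≡ 0
residues-sum-even x y z 2∣x+y+z = n∣m⇒m%n≡0 r 2 (∣m+n∣m⇒∣n (subst (2 ℕD.∣_) sum≡ 2∣x+y+z) (n∣m*n q))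
  where
  open DivMod
  r = toℕ (x mod 2) ℕ.+ toℕ (y mod 2) ℕ.+ toℕ (z mod 2)
  q = x / 2 ℕ.+ y / 2 ℕ.+ z / 2
  regroup : ∀ rx ry rz qx qy qz → (rx ℕ.+ qx ℕ.* 2) ℕ.+ (ry ℕ.+ qy ℕ.* 2) ℕ.+ (rz ℕ.+ qz ℕ.* 2)
    ≡ (qx ℕ.+ qy ℕ.+ qz) ℕ.* 2 ℕ.+ (rx ℕ.+ ry ℕ.+ rz)
  regroup = ℕ-Solver.solve-∀
  sum≡ : x ℕ.+ y ℕ.+ z ≡ q ℕ.* 2 ℕ.+ r
  sum≡ = trans (cong₂ ℕ._+_ (cong₂ ℕ._+_ (property (x divMod 2)) (property (y divMod 2))) (property (z divMod 2)))
               (regroup (toℕ (x mod 2)) (toℕ (y mod 2)) (toℕ (z mod 2)) (x / 2) (y / 2) (z / 2))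

mod2≡0⇒≡/2*2 : ∀ x → x mod 2 ≡ zero → x ≡ x / 2 ℕ.* 2
mod2≡0⇒≡/2*2 x even = trans (DivMod.property (x divMod 2)) (cong (λ r → toℕ r ℕ.+ x / 2 ℕ.* 2) even)

zeroSum*2⇒mono : ∀ a b c → Odd a → Odd b → Odd c → ∀ m → ZeroSumProp a b c (m ℕ.* 2) → MonoProp a b c m
zeroSum*2⇒mono a b c odd-a odd-b odd-c m zs χ with zs (lift χ)
... | x , y , z , sol@(_ , _ , _ , eq) , zeroSum
  with liftColour-zeroSum (x mod 2) (y mod 2) (z mod 2) (χ (x / 2)) (χ (y / 2)) (χ (z / 2))
         (residues-sum-even x y z (solution-sum-even a b c odd-a odd-b odd-c eq)) zeroSum
... | x-even , y-even , z-even , f≡g , g≡h =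
  x / 2 , y / 2 , z / 2 ,
  IsSolution-cancelʳ 2 {a} {b} {c} halved , f≡g , g≡h
  where
  halved : IsSolution a b c (m ℕ.* 2) (x / 2 ℕ.* 2) (y / 2 ℕ.* 2) (z / 2 ℕ.* 2)
  halved = IsSolution-resp {a} {b} {c}
    (mod2≡0⇒≡/2*2 x x-even) (mod2≡0⇒≡/2*2 y y-even) (mod2≡0⇒≡/2*2 z z-even) sol

¬zeroSum-1 : ∀ a b c → Odd a → Odd b → Odd c → ¬ ZeroSumProp a b c 1
¬zeroSum-1 a b c odd-a odd-b odd-c zs with zs (λ _ → zero)
... | x , y , z , (x∈ , y∈ , z∈ , eq) , _
  with solution-sum-even a b c odd-a odd-b odd-c eq | InRange-1 x∈ | InRange-1 y∈ | InRange-1 z∈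
... | 2∣3 | refl | refl | refl = case n∣m⇒m%n≡0 3 2 2∣3 of λ ()

eventually-zeroSum⇒eventually-mono : ∀ a b c → Odd a → Odd b → Odd c → ∀ k →
  Eventually (ZeroSumProp a b c) (suc (suc k)) → Eventually (MonoProp a b c) (suc k)
eventually-zeroSum⇒eventually-mono a b c odd-a odd-b odd-c k zs (suc m) (s≤s k≤m) =
  zeroSum*2⇒mono a b c odd-a odd-b odd-c (suc m) (zs (suc m ℕ.* 2) (s≤s (s≤s (≤-trans k≤m (m≤m*n m 2)))))

corollary2 : (a b c : ℤ) → Odd a → Odd b → Odd c →
    (N : ℕ) → IsRZ3 a b c N → ¬ IsR2 a b c N
corollary2 a b c odd-a odd-b odd-c zero (zs , _) _ = ¬zeroSum-1 a b c odd-a odd-b odd-c (zs 1 z≤n)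
corollary2 a b c odd-a odd-b odd-c (suc zero) (zs , _) _ = ¬zeroSum-1 a b c odd-a odd-b odd-c (zs 1 ≤-refl)
corollary2 a b c odd-a odd-b odd-c (suc (suc k)) (zs , _) (_ , least) =
  n≮n (suc k) (least (suc k) (eventually-zeroSum⇒eventually-mono a b c odd-a odd-b odd-c k zs))
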